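{- Let $\ell,\ell',\ell''$ be positive integers, and let $(F^1,(x^1_1,\ldots,x^1_\ell),(y^1_1,\ldots,y^1_{\ell'}))$ and $(F^2,(x^2_1,\ldots,x^2_{\ell'}),(y^2_1,\ldots,y^2_{\ell''}))$ be two links with disjoint vertex sets. Let $F$ be the ordered graph obtained from $F^1$ and $F^2$ by identifying $y^1_i$ with $x^2_i$ for each $i\in[\ell']$, where the order of $F$ lists the vertices of $F^1$ in their order followed by the remaining vertices of $F^2$ in their order. Then $(F,(x^1_1,\ldots,x^1_\ell),(y^2_1,\ldots,y^2_{\ell''}))$ is a link.
   Context: An ordered graph is a finite simple graph with a fixed linear order $\prec$ of its vertices. $M$ denotes the ordered graph with vertices $v_1\prec v_2\prec v_3\prec v_4$ and exactly the edges $v_1v_4$, $v_2v_3$; an ordered graph is $M$-free if it has no induced (order-preserving) subgraph isomorphic to $M$. For positive integers $\ell,\ell'$, a link is a tuple $(F,(x_1,\ldots,x_\ell),(y_1,\ldots,y_{\ell'}))$ where $F$ is an ordered graph such that: (1) $x_1,\ldots,x_\ell$ are, in this order, the first $\ell$ vertices of $F$; (2) $y_1,\ldots,y_{\ell'}$ are, in this order, the last $\ell'$ vertices of $F$; (3) $\{x_1,\dots,x_\ell\}$ and $\{y_1,\dots,y_{\ell'}\}$ are disjoint independent sets; (4) $F$ is $M$-free. The $x_i$ are input vertices and the $y_i$ output vertices. -}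

module Defs where

open import Data.Nat using (ℕ; _+_; _∸_; _≤_; _<_)
open import Data.Fin using (Fin; toℕ)
open import Data.Product using (Σ; ∃; _×_; _,_)
open import Data.Sum using (_⊎_)
open import Relation.Nullary using (¬_)
open import Relation.Binary.PropositionalEquality using (_≡_)

-- An ordered graph on n vertices: vertex set Fin n, linear order = the usual
-- order of Fin n (compare via toℕ), edge relation E (simplicity is imposed
-- separately by IsSimple).
Rel : ℕ → Set₁
Rel n = Fin n → Fin n → Set

record IsSimple {n : ℕ} (E : Rel n) : Set where
  field
    sym     : ∀ u v → E u v → E v u
    irrefl  : ∀ v → ¬ E v v

InducedM : {n : ℕ} → Rel n → Set
InducedM {n} E =
  Σ (Fin n) λ a → Σ (Fin n) λ b → Σ (Fin n) λ c → Σ (Fin n) λ d →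
    (toℕ a < toℕ b) × (toℕ b < toℕ c) × (toℕ c < toℕ d) ×
    E a d × E b c ×
    ¬ E a b × ¬ E a c × ¬ E b d × ¬ E c d

MFree : {n : ℕ} → Rel n → Set
MFree E = ¬ InducedM E

-- (F, (x_1..x_ℓ), (y_1..y_ℓ')) is a link, where x_i is the i-th vertex of F
-- (index i-1) and y_j is the vertex with index n ∸ ℓ' + (j-1).
record IsLink (n : ℕ) (E : Rel n) (ℓ ℓ' : ℕ) : Set where
  field
    simple        : IsSimple E
    -- the input and output sets are disjoint (both are order-intervals)
    disjoint      : ℓ + ℓ' ≤ n
    inputsIndep   : ∀ u v → toℕ u < ℓ → toℕ v < ℓ → ¬ E u v
    outputsIndep  : ∀ u v → n ∸ ℓ' ≤ toℕ u → n ∸ ℓ' ≤ toℕ v → ¬ E u v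
    mFree         : MFree E

-- Gluing: F¹ has n₁ vertices, F² has n₂ vertices; the last ℓ' vertices of F¹
-- (its outputs) are identified with the first ℓ' vertices of F² (its inputs),
-- in order.
-- Vertex v of the glued graph is the image of vertex j of F¹ iff toℕ v ≡ toℕ j,
-- and the image of vertex k of F² iff toℕ v + ℓ' ≡ n₁ + toℕ k.
Glued : (n₁ n₂ ℓ' : ℕ) → Rel n₁ → Rel n₂ → Rel (n₁ + (n₂ ∸ ℓ'))
Glued n₁ n₂ ℓ' E₁ E₂ u v =
  (Σ (Fin n₁) λ j → Σ (Fin n₁) λ j' →
     (toℕ u ≡ toℕ j) × (toℕ v ≡ toℕ j') × E₁ j j')
  ⊎
  (Σ (Fin n₂) λ k → Σ (Fin n₂) λ k' →
     (toℕ u + ℓ' ≡ n₁ + toℕ k) × (toℕ v + ℓ' ≡ n₁ + toℕ k') × E₂ k k')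

-- In the glued graph every edge lies inside the copy of F¹ (the first n₁
-- vertices) or inside the copy of F² (the last n₂ vertices), and each copy is
-- an induced, order-preserving subgraph: a stray edge of the other link inside
-- a copy would join two vertices of the shared interval, which is independent
-- in both links. An induced M has its edge ad in one copy; if it is in the
-- copy of F², then a and hence b, c, d are in that up-closed copy, and
-- otherwise ad lies in the copy of F¹, so d and hence a, b, c are in that
-- down-closed copy. Either way M would be induced in F¹ or in F².
module Submission where

open import Defs
open import Data.Nat using (ℕ; _+_; _∸_; _≤_; _<_; _≤?_)
open import Data.Nat.Properties
open import Data.Fin using (Fin; toℕ; fromℕ<)
open import Data.Fin.Properties using (toℕ-injective; toℕ<n; toℕ-fromℕ<)
open import Data.Product using (_×_; _,_)
open import Data.Sum using (inj₁; inj₂)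
open import Data.Empty using (⊥-elim)
open import Relation.Nullary using (¬_; yes; no)
open import Relation.Binary.PropositionalEquality
  using (_≡_; refl; sym; trans; cong; subst; subst₂; module ≡-Reasoning)

IsInducedMOn : {n : ℕ} → Rel n → (a b c d : Fin n) → Set
IsInducedMOn E a b c d =
  (toℕ a < toℕ b) × (toℕ b < toℕ c) × (toℕ c < toℕ d) ×
  E a d × E b c × ¬ E a b × ¬ E a c × ¬ E b d × ¬ E c d

record PartialEmbedding {n m : ℕ} (E : Rel n) (E′ : Rel m) : Set₁ where
  field
    Dom       : Fin n → Set
    map       : ∀ u → Dom u → Fin m
    monotone  : ∀ {u v} pu pv → toℕ u < toℕ v → toℕ (map u pu) < toℕ (map v pv)
    preserves : ∀ {u v} pu pv → E u v → E′ (map u pu) (map v pv)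
    reflects  : ∀ {u v} pu pv → E′ (map u pu) (map v pv) → E u v

  inducedM-map : ∀ {a b c d} → Dom a → Dom b → Dom c → Dom d →
                 IsInducedMOn E a b c d → InducedM E′
  inducedM-map pa pb pc pd (ab , bc , cd , ad , ebc , nab , nac , nbd , ncd) =
    map _ pa , map _ pb , map _ pc , map _ pd ,
    monotone pa pb ab , monotone pb pc bc , monotone pc pd cd ,
    preserves pa pd ad , preserves pb pc ebc ,
    (λ e → nab (reflects pa pb e)) , (λ e → nac (reflects pa pc e)) ,
    (λ e → nbd (reflects pb pd e)) , (λ e → ncd (reflects pc pd e))

-- The shared interval of ℓ′ vertices starts at index o = n₁ ∸ ℓ′ of the glued
-- graph; vertex k of F² sits at index o + k.
module Gluing (n₁ n₂ ℓ′ : ℕ) (E₁ : Rel n₁) (E₂ : Rel n₂)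
              (ℓ′≤n₁ : ℓ′ ≤ n₁) (ℓ′≤n₂ : ℓ′ ≤ n₂) where

  N : ℕ
  N = n₁ + (n₂ ∸ ℓ′)

  G : Rel N
  G = Glued n₁ n₂ ℓ′ E₁ E₂

  o : ℕ
  o = n₁ ∸ ℓ′

  N≡o+n₂ : N ≡ o + n₂
  N≡o+n₂ = begin
    n₁ + (n₂ ∸ ℓ′)         ≡⟨ cong (_+ (n₂ ∸ ℓ′)) (sym (m∸n+n≡m ℓ′≤n₁)) ⟩
    o + ℓ′ + (n₂ ∸ ℓ′)     ≡⟨ +-assoc o ℓ′ (n₂ ∸ ℓ′) ⟩
    o + (ℓ′ + (n₂ ∸ ℓ′))   ≡⟨ cong (o +_) (m+[n∸m]≡n ℓ′≤n₂) ⟩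
    o + n₂                 ∎
    where open ≡-Reasoning

  n₁+k≡o+k+ℓ′ : ∀ k → n₁ + k ≡ o + k + ℓ′
  n₁+k≡o+k+ℓ′ k = begin
    n₁ + k          ≡⟨ cong (_+ k) (sym (m∸n+n≡m ℓ′≤n₁)) ⟩
    o + ℓ′ + k      ≡⟨ +-assoc o ℓ′ k ⟩
    o + (ℓ′ + k)    ≡⟨ cong (o +_) (+-comm ℓ′ k) ⟩
    o + (k + ℓ′)    ≡⟨ sym (+-assoc o k ℓ′) ⟩
    o + k + ℓ′      ∎
    where open ≡-Reasoning

  second-index : ∀ {x k} → x + ℓ′ ≡ n₁ + k → x ≡ o + k
  second-index {x} {k} eq = +-cancelʳ-≡ ℓ′ x (o + k) (trans eq (n₁+k≡o+k+ℓ′ k))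

  second-index⁻¹ : ∀ {x k} → x ≡ o + k → x + ℓ′ ≡ n₁ + k
  second-index⁻¹ {k = k} refl = sym (n₁+k≡o+k+ℓ′ k)

  N∸ℓ″≡o+[n₂∸ℓ″] : ∀ {ℓ″} → ℓ″ ≤ n₂ → N ∸ ℓ″ ≡ o + (n₂ ∸ ℓ″)
  N∸ℓ″≡o+[n₂∸ℓ″] {ℓ″} ℓ″≤n₂ = trans (cong (_∸ ℓ″) N≡o+n₂) (+-∸-assoc o ℓ″≤n₂)

  second-copy-≥o : ∀ {u : Fin N} (k : Fin n₂) → toℕ u + ℓ′ ≡ n₁ + toℕ k → o ≤ toℕ u
  second-copy-≥o k eq = subst (o ≤_) (sym (second-index eq)) (m≤m+n o (toℕ k))

  firstCopy : (∀ k k′ → toℕ k < ℓ′ → toℕ k′ < ℓ′ → ¬ E₂ k k′) →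
              PartialEmbedding G E₁
  firstCopy inputs₂-indep = record
    { Dom       = λ u → toℕ u < n₁
    ; map       = λ _ p → fromℕ< p
    ; monotone  = λ pu pv → subst₂ _<_ (sym (toℕ-fromℕ< pu)) (sym (toℕ-fromℕ< pv))
    ; preserves = preserves
    ; reflects  = λ pu pv e → inj₁ (_ , _ , sym (toℕ-fromℕ< pu) , sym (toℕ-fromℕ< pv) , e)
    }
    where
    in-shared-interval : ∀ {u} (k : Fin n₂) → toℕ u + ℓ′ ≡ n₁ + toℕ k → toℕ u < n₁ → toℕ k < ℓ′
    in-shared-interval k eq u<n₁ = +-cancelˡ-< o (toℕ k) ℓ′
      (subst₂ _<_ (second-index eq) (sym (m∸n+n≡m ℓ′≤n₁)) u<n₁)

    preserves : ∀ {u v} pu pv → G u v → E₁ (fromℕ< pu) (fromℕ< pv)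
    preserves pu pv (inj₁ (j , j′ , eu , ev , e)) = subst₂ E₁ (same-vertex eu pu) (same-vertex ev pv) e
      where
      same-vertex : ∀ {u} {j : Fin n₁} → toℕ u ≡ toℕ j → (pu : toℕ u < n₁) → j ≡ fromℕ< pu
      same-vertex eq pu = toℕ-injective (trans (sym eq) (sym (toℕ-fromℕ< pu)))
    preserves pu pv (inj₂ (k , k′ , eu , ev , e)) =
      ⊥-elim (inputs₂-indep k k′ (in-shared-interval k eu pu) (in-shared-interval k′ ev pv) e)

  secondCopy : (∀ j j′ → o ≤ toℕ j → o ≤ toℕ j′ → ¬ E₁ j j′) →
               PartialEmbedding G E₂
  secondCopy outputs₁-indep = record
    { Dom       = λ u → o ≤ toℕ u
    ; map       = coordinate
    ; monotone  = λ {u} {v} pu pv lt →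
        +-cancelˡ-< o _ _ (subst₂ _<_ (index-coordinate u pu) (index-coordinate v pv) lt)
    ; preserves = preserves
    ; reflects  = λ {u} {v} pu pv e →
        inj₂ (_ , _ , second-index⁻¹ (index-coordinate u pu) ,
                      second-index⁻¹ (index-coordinate v pv) , e)
    }
    where
    coordinate< : ∀ (u : Fin N) → o ≤ toℕ u → toℕ u ∸ o < n₂
    coordinate< u pu = subst (toℕ u ∸ o <_) (m+n∸m≡n o n₂)
      (∸-monoˡ-< (subst (toℕ u <_) N≡o+n₂ (toℕ<n u)) pu)

    coordinate : ∀ u → o ≤ toℕ u → Fin n₂
    coordinate u pu = fromℕ< (coordinate< u pu)

    index-coordinate : ∀ u pu → toℕ u ≡ o + toℕ (coordinate u pu)
    index-coordinate u pu = begin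
      toℕ u                 ≡⟨ sym (m+[n∸m]≡n pu) ⟩
      o + (toℕ u ∸ o)       ≡⟨ cong (o +_) (sym (toℕ-fromℕ< (coordinate< u pu))) ⟩
      o + toℕ (coordinate u pu) ∎
      where open ≡-Reasoning

    same-vertex : ∀ {u} {k : Fin n₂} → toℕ u + ℓ′ ≡ n₁ + toℕ k → (pu : o ≤ toℕ u) →
                  k ≡ coordinate u pu
    same-vertex {u} eq pu =
      toℕ-injective (+-cancelˡ-≡ o _ _ (trans (sym (second-index eq)) (index-coordinate u pu)))

    preserves : ∀ {u v} pu pv → G u v → E₂ (coordinate u pu) (coordinate v pv)
    preserves pu pv (inj₂ (k , k′ , eu , ev , e)) =
      subst₂ E₂ (same-vertex eu pu) (same-vertex ev pv) e
    preserves pu pv (inj₁ (j , j′ , eu , ev , e)) =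
      ⊥-elim (outputs₁-indep j j′ (subst (o ≤_) eu pu) (subst (o ≤_) ev pv) e)

  glued-simple : IsSimple E₁ → IsSimple E₂ → IsSimple G
  glued-simple S₁ S₂ = record { sym = symmetric ; irrefl = irreflexive }
    where
    symmetric : ∀ u v → G u v → G v u
    symmetric u v (inj₁ (j , j′ , eu , ev , e)) = inj₁ (j′ , j , ev , eu , IsSimple.sym S₁ j j′ e)
    symmetric u v (inj₂ (k , k′ , eu , ev , e)) = inj₂ (k′ , k , ev , eu , IsSimple.sym S₂ k k′ e)

    irreflexive : ∀ v → ¬ G v v
    irreflexive v (inj₁ (j , j′ , eu , ev , e)) =
      IsSimple.irrefl S₁ j′ (subst (λ i → E₁ i j′) (toℕ-injective (trans (sym eu) ev)) e)
    irreflexive v (inj₂ (k , k′ , eu , ev , e)) =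
      IsSimple.irrefl S₂ k′
        (subst (λ i → E₂ i k′) (toℕ-injective (+-cancelˡ-≡ n₁ _ _ (trans (sym eu) ev))) e)

  glued-mFree : (∀ k k′ → toℕ k < ℓ′ → toℕ k′ < ℓ′ → ¬ E₂ k k′) →
                (∀ j j′ → o ≤ toℕ j → o ≤ toℕ j′ → ¬ E₁ j j′) →
                MFree E₁ → MFree E₂ → MFree G
  glued-mFree inputs₂-indep outputs₁-indep free₁ free₂ (a , b , c , d , m@(ab , bc , cd , ad , _))
    with o ≤? toℕ a
  ... | yes pa = free₂ (inducedM-map pa pb pc pd m)
    where
    open PartialEmbedding (secondCopy outputs₁-indep)
    pb : o ≤ toℕ b
    pb = ≤-trans pa (<⇒≤ ab)
    pc : o ≤ toℕ c
    pc = ≤-trans pb (<⇒≤ bc)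
    pd : o ≤ toℕ d
    pd = ≤-trans pc (<⇒≤ cd)
  ... | no a≱o = free₁ (inducedM-map pa pb pc pd m)
    where
    open PartialEmbedding (firstCopy inputs₂-indep)
    end-in-first-copy : G a d → toℕ d < n₁
    end-in-first-copy (inj₁ (_ , j′ , _ , ev , _)) = subst (_< n₁) (sym ev) (toℕ<n j′)
    end-in-first-copy (inj₂ (k , _ , eu , _ , _)) = ⊥-elim (a≱o (second-copy-≥o k eu))
    pd : toℕ d < n₁
    pd = end-in-first-copy ad
    pc : toℕ c < n₁
    pc = <-trans cd pd
    pb : toℕ b < n₁
    pb = <-trans bc pc
    pa : toℕ a < n₁
    pa = <-trans ab pb

  glued-disjoint : ∀ {ℓ ℓ″} → ℓ ≤ o → ℓ″ ≤ n₂ → ℓ + ℓ″ ≤ N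
  glued-disjoint {ℓ} {ℓ″} ℓ≤o ℓ″≤n₂ = subst (ℓ + ℓ″ ≤_) (sym N≡o+n₂) (+-mono-≤ ℓ≤o ℓ″≤n₂)

  glued-inputsIndep : ∀ {ℓ} → ℓ ≤ o → (∀ j j′ → toℕ j < ℓ → toℕ j′ < ℓ → ¬ E₁ j j′) →
                      ∀ u v → toℕ u < ℓ → toℕ v < ℓ → ¬ G u v
  glued-inputsIndep ℓ≤o inputs₁-indep u v pu pv (inj₁ (j , j′ , eu , ev , e)) =
    inputs₁-indep j j′ (subst (_< _) eu pu) (subst (_< _) ev pv) e
  glued-inputsIndep ℓ≤o inputs₁-indep u v pu pv (inj₂ (k , _ , eu , _ , _)) =
    <⇒≱ (<-≤-trans pu ℓ≤o) (second-copy-≥o k eu)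

  glued-outputsIndep : ∀ {ℓ″} → ℓ′ + ℓ″ ≤ n₂ →
                       (∀ k k′ → n₂ ∸ ℓ″ ≤ toℕ k → n₂ ∸ ℓ″ ≤ toℕ k′ → ¬ E₂ k k′) →
                       ∀ u v → N ∸ ℓ″ ≤ toℕ u → N ∸ ℓ″ ≤ toℕ v → ¬ G u v
  glued-outputsIndep {ℓ″} ℓ′+ℓ″≤n₂ outputs₂-indep u v pu pv (inj₂ (k , k′ , eu , ev , e)) =
    outputs₂-indep k k′ (output-coordinate eu pu) (output-coordinate ev pv) e
    where
    output-coordinate : ∀ {u : Fin N} {k : Fin n₂} → toℕ u + ℓ′ ≡ n₁ + toℕ k →
                        N ∸ ℓ″ ≤ toℕ u → n₂ ∸ ℓ″ ≤ toℕ k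
    output-coordinate eq p = +-cancelˡ-≤ o _ _
      (subst₂ _≤_ (N∸ℓ″≡o+[n₂∸ℓ″] (m+n≤o⇒n≤o ℓ′ ℓ′+ℓ″≤n₂)) (second-index eq) p)
  glued-outputsIndep {ℓ″} ℓ′+ℓ″≤n₂ outputs₂-indep u v pu pv (inj₁ (j , _ , eu , _ , _)) =
    <⇒≱ (subst (_< n₁) (sym eu) (toℕ<n j)) (begin
      n₁                    ≡⟨ sym (m∸n+n≡m ℓ′≤n₁) ⟩
      o + ℓ′                ≤⟨ +-monoʳ-≤ o (m+n≤o⇒m≤o∸n ℓ′ ℓ′+ℓ″≤n₂) ⟩
      o + (n₂ ∸ ℓ″)         ≡⟨ sym (N∸ℓ″≡o+[n₂∸ℓ″] (m+n≤o⇒n≤o ℓ′ ℓ′+ℓ″≤n₂)) ⟩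
      N ∸ ℓ″                ≤⟨ pu ⟩
      toℕ u                 ∎)
    where open ≤-Reasoning

glued-isLink : ∀ {ℓ ℓ′ ℓ″ n₁ n₂} {E₁ : Rel n₁} {E₂ : Rel n₂} →
               IsLink n₁ E₁ ℓ ℓ′ → IsLink n₂ E₂ ℓ′ ℓ″ →
               IsLink (n₁ + (n₂ ∸ ℓ′)) (Glued n₁ n₂ ℓ′ E₁ E₂) ℓ ℓ″
glued-isLink {ℓ} {ℓ′} {ℓ″} {n₁} {n₂} {E₁} {E₂} L₁ L₂ = record
  { simple       = glued-simple L₁.simple L₂.simple
  ; disjoint     = glued-disjoint ℓ≤o (m+n≤o⇒n≤o ℓ′ L₂.disjoint)
  ; inputsIndep  = glued-inputsIndep ℓ≤o L₁.inputsIndep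
  ; outputsIndep = glued-outputsIndep L₂.disjoint L₂.outputsIndep
  ; mFree        = glued-mFree L₂.inputsIndep L₁.outputsIndep L₁.mFree L₂.mFree
  }
  where
  module L₁ = IsLink L₁
  module L₂ = IsLink L₂
  open Gluing n₁ n₂ ℓ′ E₁ E₂ (m+n≤o⇒n≤o ℓ L₁.disjoint) (m+n≤o⇒m≤o ℓ′ L₂.disjoint)

  ℓ≤o : ℓ ≤ o
  ℓ≤o = m+n≤o⇒m≤o∸n ℓ L₁.disjoint

mainTheorem6 : (ℓ ℓ' ℓ'' : ℕ) → 1 ≤ ℓ → 1 ≤ ℓ' → 1 ≤ ℓ'' →
    (n₁ n₂ : ℕ) (E₁ : Rel n₁) (E₂ : Rel n₂) →
    IsLink n₁ E₁ ℓ ℓ' → IsLink n₂ E₂ ℓ' ℓ'' →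
    IsLink (n₁ + (n₂ ∸ ℓ')) (Glued n₁ n₂ ℓ' E₁ E₂) ℓ ℓ''
mainTheorem6 _ _ _ _ _ _ _ _ _ _ L₁ L₂ = glued-isLink L₁ L₂
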